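{- Let $w$ be a fully commutative permutation with $\mathrm{Row}_2(P(w)) = \{z_1 < z_2 < \cdots < z_t\}$. For each $i \in \{1,\dots,t\}$, let $b_i$ be the value that bumps $z_i$ from the first row to the second row during the construction of $P(w)$. Then: (a) the values $z_1, z_2, \ldots, z_t$ appear from left to right in the one-line notation of $w$; (b) the sets $\{z_1,\dots,z_t\}$ and $\{b_1,\dots,b_t\}$ are disjoint; (c) $b_1 b_2 \cdots b_t$ is an increasing subsequence of $w$ (i.e., $b_1<\cdots<b_t$ and they appear from left to right in $w$); (d) for $1 \le i < j \le t$, during RSK insertion the value $z_i$ is bumped before $z_j$.
   Context: A permutation is fully commutative iff it avoids $321$. $P(w)$ is the RSK insertion tableau obtained by row-inserting $w(1),\dots,w(n)$ in order: inserting $x$ into a row places $x$ at the end if it exceeds all entries, and otherwise replaces ("bumps") the smallest entry larger than $x$, which is then inserted into the next row. For fully commutative $w$, $P(w)$ has at most two rows; $\mathrm{Row}_2(P(w))$ is the set of second-row entries. -}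

module Defs where

open import Data.Nat using (ℕ; suc; _<_; _<ᵇ_)
open import Data.Bool using (true; false)
open import Data.List using (List; []; _∷_; _++_; [_]; map; upTo)
open import Data.Maybe using (Maybe; just; nothing)
open import Data.Product using (_×_; _,_; ∃; ∃-syntax)
open import Relation.Nullary using (¬_)
open import Data.List.Relation.Binary.Sublist.Propositional using (_⊆_)
open import Data.List.Relation.Binary.Permutation.Propositional using (_↭_)

IsPerm : ℕ → List ℕ → Set
IsPerm n w = w ↭ map suc (upTo n)

Avoids321 : List ℕ → Set
Avoids321 w = ¬ (∃[ a ] ∃[ b ] ∃[ c ] ((c ∷ b ∷ a ∷ []) ⊆ w × a < b × b < c))

FullyCommutative : List ℕ → Set
FullyCommutative = Avoids321

Row : Set
Row = List ℕ

Tableau : Set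
Tableau = List Row

insertRow : ℕ → Row → Row × Maybe ℕ
insertRow x [] = [ x ] , nothing
insertRow x (y ∷ ys) with x <ᵇ y
... | true = x ∷ ys , just y
... | false with insertRow x ys
...   | r , m = y ∷ r , m

insertT : ℕ → Tableau → Tableau
insertT x [] = [ x ] ∷ []
insertT x (r ∷ rs) with insertRow x r
... | r' , nothing = r' ∷ rs
... | r' , just y  = r' ∷ insertT y rs

insertAll : Tableau → List ℕ → Tableau
insertAll T [] = T
insertAll T (x ∷ xs) = insertAll (insertT x T) xs

P : List ℕ → Tableau
P w = insertAll [] w

row1 : Tableau → Row
row1 [] = []
row1 (r ∷ _) = r

row2 : Tableau → Row
row2 (_ ∷ r ∷ _) = r
row2 _ = []

-- Chronological list of bump events out of the FIRST row during the
-- construction of P(w): an entry (b , z) means that inserting the value b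
-- bumped z from the first row into the second row.
bumpsFrom : Tableau → List ℕ → List (ℕ × ℕ)
bumpsFrom T [] = []
bumpsFrom T (x ∷ xs) with insertRow x (row1 T)
... | _ , nothing = bumpsFrom (insertT x T) xs
... | _ , just z  = (x , z) ∷ bumpsFrom (insertT x T) xs

row1Bumps : List ℕ → List (ℕ × ℕ)
row1Bumps w = bumpsFrom [] w

-- Track, along the prefix u of w read so far, the split u = u₁ ++ u₂ at the last value that was
-- bumped out of row 1. Every entry of row 1 either occurs in u₂ or lies below the smaller entry
-- of an inversion of u. If the next letter x bumps z, then z cannot lie below an inversion q < p
-- (p q x would be a 321), so z occurs after every earlier bumped value; and every earlier bumped
-- value y is smaller than z, since y z x would be a 321 otherwise. Hence row 2 only grows at its
-- end, the tableau keeps two rows, and the bumped values arrive in increasing order and in the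
-- order of w. Every earlier bumper b is below x (z' b x is a 321 for the value z' that b bumped),
-- so the bumpers increase too.
module Submission where

open import Defs
open import Data.Nat using (ℕ; _<_; _<ᵇ_)
open import Data.Nat.Properties using (<ᵇ-reflects-<; ≮⇒≥; ≤∧≢⇒<; <⇒≢; <-irrefl; <-asym; <-trans; suc-injective)
open import Data.List using (List; []; _∷_; _++_; [_]; map)
open import Data.List.Properties using (++-assoc; ++-identityʳ; map-++)
open import Data.Maybe using (Maybe; just; nothing)
open import Data.Product using (_×_; _,_; proj₁; proj₂; ∃-syntax)
open import Data.Sum using (_⊎_; inj₁; inj₂)
open import Data.Empty using (⊥-elim)
open import Function using (_∘_; id)
open import Relation.Nullary using (¬_)
open import Relation.Nullary.Reflects using (ofʸ; ofⁿ)
open import Relation.Binary.PropositionalEquality using (_≡_; refl; sym; trans; cong; subst; subst₂; _≢_; module ≡-Reasoning)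
open import Relation.Binary.PropositionalEquality.Properties using (setoid)
open import Data.List.Membership.Propositional using (_∈_; _∉_)
open import Data.List.Membership.Propositional.Properties using (∈-++⁺ˡ; ∈-++⁺ʳ; ∈-++⁻; ∈-∃++; ∈-map⁺; ∈-map⁻)
open import Data.List.Relation.Unary.Any using (here; there)
open import Data.List.Relation.Unary.All as All using (All; []; _∷_)
import Data.List.Relation.Unary.All.Properties as All
open import Data.List.Relation.Unary.AllPairs as AllPairs using (AllPairs; []; _∷_)
import Data.List.Relation.Unary.AllPairs.Properties as AllPairs
open import Data.List.Relation.Unary.Linked using (Linked)
open import Data.List.Relation.Unary.Linked.Properties using (AllPairs⇒Linked)
open import Data.List.Relation.Unary.Unique.Propositional using (Unique)
import Data.List.Relation.Unary.Unique.Propositional.Properties as Unique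
open import Data.List.Relation.Binary.Sublist.Propositional using (_⊆_; []; ⊆-refl; from∈; lookup)
open import Data.List.Relation.Binary.Sublist.Propositional.Properties using (++⁺; ++⁺ˡ; ++⁺ʳ)
open import Data.List.Relation.Binary.Pointwise as Pointwise using (Pointwise; []; _∷_; Pointwise-≡⇒≡)
open import Data.List.Relation.Binary.Permutation.Propositional using (↭⇒↭ₛ; ↭-sym)
import Data.List.Relation.Binary.Permutation.Setoid.Properties as Permutation

Increasing : List ℕ → Set
Increasing = AllPairs _<_

++-regroup : ∀ {A : Set} (a b : List A) z c d → (a ++ (b ++ z ∷ c)) ++ d ≡ (a ++ b ++ [ z ]) ++ (c ++ d)
++-regroup [] [] z c d = refl
++-regroup [] (y ∷ b) z c d = cong (y ∷_) (++-regroup [] b z c d)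
++-regroup (y ∷ a) b z c d = cong (y ∷_) (++-regroup a b z c d)

Unique-++⁻ˡ : ∀ {A : Set} (u : List A) {v} → Unique (u ++ v) → Unique u
Unique-++⁻ˡ [] _ = []
Unique-++⁻ˡ (a ∷ u) (a∉ ∷ U) = All.++⁻ˡ u a∉ ∷ Unique-++⁻ˡ u U

Unique-++⇒disjoint : ∀ {A : Set} (u : List A) {v y z} → Unique (u ++ v) → y ∈ u → z ∈ v → y ≢ z
Unique-++⇒disjoint (a ∷ u) (a∉ ∷ _) (here refl) z∈v = All.lookup a∉ (∈-++⁺ʳ u z∈v)
Unique-++⇒disjoint (a ∷ u) (_ ∷ U) (there y∈u) z∈v = Unique-++⇒disjoint u U y∈u z∈v

Unique-∷ʳ⇒∉ : ∀ {A : Set} (u : List A) {x} → Unique (u ++ [ x ]) → x ∉ u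
Unique-∷ʳ⇒∉ u U x∈u = Unique-++⇒disjoint u U x∈u (here refl) refl

IsPerm⇒Unique : ∀ n w → IsPerm n w → Unique w
IsPerm⇒Unique n w perm =
  Permutation.Unique-resp-↭ (setoid ℕ) (↭⇒↭ₛ (↭-sym perm)) (Unique.map⁺ suc-injective (Unique.upTo⁺ n))

Avoids321-++⁻ˡ : ∀ {u} v → Avoids321 (u ++ v) → Avoids321 u
Avoids321-++⁻ˡ v avoids (a , b , c , cba⊆u , a<b , b<c) = avoids (a , b , c , ++⁺ʳ v cba⊆u , a<b , b<c)

Avoids321⇒¬below-inversion : ∀ {u x p q} → Avoids321 (u ++ [ x ]) → (p ∷ q ∷ []) ⊆ u → q < p → ¬ x < q
Avoids321⇒¬below-inversion avoids pq⊆u q<p x<q = avoids (_ , _ , _ , ++⁺ pq⊆u ⊆-refl , x<q , q<p)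

data RowInsertion (x : ℕ) (r : Row) : Row × Maybe ℕ → Set where
  appended : All (_< x) r → RowInsertion x r (r ++ [ x ] , nothing)
  bumped   : ∀ {r′ z} → x < z → z ∈ r → Increasing r′ →
             (∀ {e} → e ∈ r′ → e ≡ x ⊎ (e ∈ r × e < x) ⊎ (e ∈ r × z < e)) →
             RowInsertion x r (r′ , just z)

RowInsertion-∷ : ∀ {x y ys r′ m} → y < x → All (y <_) ys →
                 RowInsertion x ys (r′ , m) → RowInsertion x (y ∷ ys) (y ∷ r′ , m)
RowInsertion-∷ y<x _ (appended ys<x) = appended (y<x ∷ ys<x)
RowInsertion-∷ {x} {y} {ys} {r′} y<x y<ys (bumped {z = z} x<z z∈ys r′↑ classify) =
  bumped x<z (there z∈ys) (All.tabulate y<r′ ∷ r′↑) classify′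
  where
  y<r′ : ∀ {e} → e ∈ r′ → y < e
  y<r′ e∈r′ with classify e∈r′
  ... | inj₁ refl = y<x
  ... | inj₂ (inj₁ (e∈ys , _)) = All.lookup y<ys e∈ys
  ... | inj₂ (inj₂ (e∈ys , _)) = All.lookup y<ys e∈ys
  classify′ : ∀ {e} → e ∈ y ∷ r′ → e ≡ x ⊎ (e ∈ y ∷ ys × e < x) ⊎ (e ∈ y ∷ ys × z < e)
  classify′ (here refl) = inj₂ (inj₁ (here refl , y<x))
  classify′ (there e∈r′) with classify e∈r′
  ... | inj₁ e≡x = inj₁ e≡x
  ... | inj₂ (inj₁ (e∈ys , e<x)) = inj₂ (inj₁ (there e∈ys , e<x))
  ... | inj₂ (inj₂ (e∈ys , z<e)) = inj₂ (inj₂ (there e∈ys , z<e))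

insertRow-spec : ∀ x r → Increasing r → x ∉ r → RowInsertion x r (insertRow x r)
insertRow-spec x [] _ _ = appended []
insertRow-spec x (y ∷ ys) (y<ys ∷ ys↑) x∉ with x <ᵇ y | <ᵇ-reflects-< x y
... | _ | ofʸ x<y = bumped x<y (here refl) (All.map (<-trans x<y) y<ys ∷ ys↑) classify
  where
  classify : ∀ {e} → e ∈ x ∷ ys → e ≡ x ⊎ (e ∈ y ∷ ys × e < x) ⊎ (e ∈ y ∷ ys × y < e)
  classify (here e≡x) = inj₁ e≡x
  classify (there e∈ys) = inj₂ (inj₂ (there e∈ys , All.lookup y<ys e∈ys))
... | _ | ofⁿ x≮y with insertRow x ys | insertRow-spec x ys ys↑ (x∉ ∘ there)
...   | _ , _ | ys-insertion = RowInsertion-∷ y<x y<ys ys-insertion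
  where
  y<x : y < x
  y<x = ≤∧≢⇒< (≮⇒≥ x≮y) (λ y≡x → x∉ (here (sym y≡x)))

insertRow-above-all : ∀ x r → All (_< x) r → insertRow x r ≡ (r ++ [ x ] , nothing)
insertRow-above-all x [] [] = refl
insertRow-above-all x (y ∷ ys) (y<x ∷ ys<x) with x <ᵇ y | <ᵇ-reflects-< x y
... | _ | ofʸ x<y = ⊥-elim (<-asym y<x x<y)
... | _ | ofⁿ _ rewrite insertRow-above-all x ys ys<x = refl

BelowInversion : List ℕ → ℕ → Set
BelowInversion u e = ∃[ p ] ∃[ q ] ((p ∷ q ∷ []) ⊆ u × q < p × e < q)

BelowInversion-++ : ∀ {u e} v → BelowInversion u e → BelowInversion (u ++ v) e
BelowInversion-++ v (p , q , pq⊆u , q<p , e<q) = p , q , ++⁺ʳ v pq⊆u , q<p , e<q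

record Invariant (u : List ℕ) (r₁ r₂ : Row) (L : List (ℕ × ℕ)) : Set where
  field
    upToLastBump sinceLastBump : List ℕ
    split                 : u ≡ upToLastBump ++ sinceLastBump
    row₁-increasing       : Increasing r₁
    row₂-increasing       : Increasing r₂
    row₁-occurs           : ∀ {e} → e ∈ r₁ → e ∈ u
    row₂-⊆                : r₂ ⊆ upToLastBump
    bumped≡row₂           : map proj₂ L ≡ r₂
    bumpers-⊆             : map proj₁ L ⊆ u
    bumpers-increasing    : Increasing (map proj₁ L)
    bump-inverts          : ∀ {b z} → (b , z) ∈ L → (z ∷ b ∷ []) ⊆ u × b < z
    row₂-disjoint-bumpers : ∀ {e} → e ∈ r₂ → e ∉ map proj₁ L
    row₁-late             : ∀ {e} → e ∈ r₁ → e ∈ sinceLastBump ⊎ BelowInversion u e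

Invariant-[] : Invariant [] [] [] []
Invariant-[] = record
  { upToLastBump = [] ; sinceLastBump = [] ; split = refl
  ; row₁-increasing = [] ; row₂-increasing = [] ; row₁-occurs = λ () ; row₂-⊆ = []
  ; bumped≡row₂ = refl ; bumpers-⊆ = [] ; bumpers-increasing = []
  ; bump-inverts = λ () ; row₂-disjoint-bumpers = λ () ; row₁-late = λ () }

Invariant-append : ∀ {u r₁ r₂ L x} → Invariant u r₁ r₂ L → All (_< x) r₁ →
                   Invariant (u ++ [ x ]) (r₁ ++ [ x ]) r₂ L
Invariant-append {u} {r₁} {r₂} {L} {x} I r₁<x = record
  { upToLastBump = upToLastBump ; sinceLastBump = sinceLastBump ++ [ x ]
  ; split = trans (cong (_++ [ x ]) split) (++-assoc upToLastBump sinceLastBump [ x ])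
  ; row₁-increasing = AllPairs.++⁺ row₁-increasing ([] ∷ []) (All.map (_∷ []) r₁<x)
  ; row₂-increasing = row₂-increasing
  ; row₁-occurs = row₁-occurs′
  ; row₂-⊆ = row₂-⊆
  ; bumped≡row₂ = bumped≡row₂
  ; bumpers-⊆ = ++⁺ʳ [ x ] bumpers-⊆
  ; bumpers-increasing = bumpers-increasing
  ; bump-inverts = λ bz∈L → ++⁺ʳ [ x ] (proj₁ (bump-inverts bz∈L)) , proj₂ (bump-inverts bz∈L)
  ; row₂-disjoint-bumpers = row₂-disjoint-bumpers
  ; row₁-late = row₁-late′
  }
  where
  open Invariant I
  row₁-occurs′ : ∀ {e} → e ∈ r₁ ++ [ x ] → e ∈ u ++ [ x ]
  row₁-occurs′ e∈ with ∈-++⁻ r₁ e∈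
  ... | inj₁ e∈r₁ = ∈-++⁺ˡ (row₁-occurs e∈r₁)
  ... | inj₂ e∈[x] = ∈-++⁺ʳ u e∈[x]
  row₁-late′ : ∀ {e} → e ∈ r₁ ++ [ x ] → e ∈ sinceLastBump ++ [ x ] ⊎ BelowInversion (u ++ [ x ]) e
  row₁-late′ e∈ with ∈-++⁻ r₁ e∈
  ... | inj₂ e∈[x] = inj₁ (∈-++⁺ʳ sinceLastBump e∈[x])
  ... | inj₁ e∈r₁ with row₁-late e∈r₁
  ...   | inj₁ e∈since = inj₁ (∈-++⁺ˡ e∈since)
  ...   | inj₂ below = inj₂ (BelowInversion-++ [ x ] below)

module _ {u r₁ r₂ L x} (I : Invariant u r₁ r₂ L)
         (unique : Unique (u ++ [ x ])) (avoids : Avoids321 (u ++ [ x ])) where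
  open Invariant I

  x∉u : x ∉ u
  x∉u = Unique-∷ʳ⇒∉ u unique

  x∉row₁ : x ∉ r₁
  x∉row₁ = x∉u ∘ row₁-occurs

  bumpers<x : ∀ {b} → b ∈ map proj₁ L → b < x
  bumpers<x b∈ with ∈-map⁻ proj₁ b∈
  ... | _ , bz∈L , refl =
    ≤∧≢⇒< (≮⇒≥ (Avoids321⇒¬below-inversion avoids zb⊆u b<z)) (λ { refl → x∉u (lookup bumpers-⊆ b∈) })
    where
    zb⊆u = proj₁ (bump-inverts bz∈L)
    b<z = proj₂ (bump-inverts bz∈L)

  module _ {r₁′ z} (x<z : x < z) (z∈r₁ : z ∈ r₁) (r₁′-increasing : Increasing r₁′)
           (classify : ∀ {e} → e ∈ r₁′ → e ≡ x ⊎ (e ∈ r₁ × e < x) ⊎ (e ∈ r₁ × z < e)) where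

    bumped-since-last-bump : z ∈ sinceLastBump
    bumped-since-last-bump with row₁-late z∈r₁
    ... | inj₁ z∈since = z∈since
    ... | inj₂ (_ , _ , pq⊆u , q<p , z<q) =
      ⊥-elim (Avoids321⇒¬below-inversion avoids pq⊆u q<p (<-trans x<z z<q))

    -- An entry y of row 2 precedes z in u, so y > z would make y z x a 321.
    row₂<bumped : All (_< z) r₂
    row₂<bumped = All.tabulate λ y∈r₂ →
      let y∈up = lookup row₂-⊆ y∈r₂
          yz⊆u = subst ((_ ∷ z ∷ []) ⊆_) (sym split) (++⁺ (from∈ y∈up) (from∈ bumped-since-last-bump))
      in ≤∧≢⇒< (≮⇒≥ λ z<y → Avoids321⇒¬below-inversion avoids yz⊆u z<y x<z)
               (Unique-++⇒disjoint upToLastBump (subst Unique split (Unique-++⁻ˡ u unique))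
                  y∈up bumped-since-last-bump)

    Invariant-bump : Invariant (u ++ [ x ]) r₁′ (r₂ ++ [ z ]) (L ++ [ (x , z) ])
    Invariant-bump = record
      { upToLastBump = upToLastBump ++ beforeZ ++ [ z ] ; sinceLastBump = afterZ ++ [ x ]
      ; split = split′
      ; row₁-increasing = r₁′-increasing
      ; row₂-increasing = AllPairs.++⁺ row₂-increasing ([] ∷ []) (All.map (_∷ []) row₂<bumped)
      ; row₁-occurs = row₁-occurs′
      ; row₂-⊆ = ++⁺ row₂-⊆ (++⁺ˡ beforeZ ⊆-refl)
      ; bumped≡row₂ = trans (map-++ proj₂ L _) (cong (_++ [ z ]) bumped≡row₂)
      ; bumpers-⊆ = subst (_⊆ u ++ [ x ]) (sym (map-++ proj₁ L _)) (++⁺ bumpers-⊆ ⊆-refl)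
      ; bumpers-increasing = subst Increasing (sym (map-++ proj₁ L _))
          (AllPairs.++⁺ bumpers-increasing ([] ∷ []) (All.tabulate λ b∈ → bumpers<x b∈ ∷ []))
      ; bump-inverts = bump-inverts′
      ; row₂-disjoint-bumpers = row₂-disjoint-bumpers′
      ; row₁-late = row₁-late′
      }
      where
      beforeZ afterZ : List ℕ
      beforeZ = proj₁ (∈-∃++ bumped-since-last-bump)
      afterZ = proj₁ (proj₂ (∈-∃++ bumped-since-last-bump))
      since≡ : sinceLastBump ≡ beforeZ ++ z ∷ afterZ
      since≡ = proj₂ (proj₂ (∈-∃++ bumped-since-last-bump))

      split′ : u ++ [ x ] ≡ (upToLastBump ++ beforeZ ++ [ z ]) ++ (afterZ ++ [ x ])
      split′ = begin
        u ++ [ x ]                                     ≡⟨ cong (_++ [ x ]) split ⟩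
        (upToLastBump ++ sinceLastBump) ++ [ x ]       ≡⟨ cong (λ s → (upToLastBump ++ s) ++ [ x ]) since≡ ⟩
        (upToLastBump ++ (beforeZ ++ z ∷ afterZ)) ++ [ x ] ≡⟨ ++-regroup upToLastBump beforeZ z afterZ [ x ] ⟩
        (upToLastBump ++ beforeZ ++ [ z ]) ++ (afterZ ++ [ x ]) ∎
        where open ≡-Reasoning

      zx⊆ : (z ∷ x ∷ []) ⊆ u ++ [ x ]
      zx⊆ = ++⁺ (from∈ (row₁-occurs z∈r₁)) ⊆-refl

      row₁-occurs′ : ∀ {e} → e ∈ r₁′ → e ∈ u ++ [ x ]
      row₁-occurs′ e∈ with classify e∈
      ... | inj₁ refl = ∈-++⁺ʳ u (here refl)
      ... | inj₂ (inj₁ (e∈r₁ , _)) = ∈-++⁺ˡ (row₁-occurs e∈r₁)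
      ... | inj₂ (inj₂ (e∈r₁ , _)) = ∈-++⁺ˡ (row₁-occurs e∈r₁)

      bump-inverts′ : ∀ {b z′} → (b , z′) ∈ L ++ [ (x , z) ] → (z′ ∷ b ∷ []) ⊆ u ++ [ x ] × b < z′
      bump-inverts′ bz∈ with ∈-++⁻ L bz∈
      ... | inj₁ bz∈L = ++⁺ʳ [ x ] (proj₁ (bump-inverts bz∈L)) , proj₂ (bump-inverts bz∈L)
      ... | inj₂ (here refl) = zx⊆ , x<z

      row₂-disjoint-bumpers′ : ∀ {e} → e ∈ r₂ ++ [ z ] → e ∉ map proj₁ (L ++ [ (x , z) ])
      row₂-disjoint-bumpers′ {e} e∈row₂ e∈bumpers
        with ∈-++⁻ r₂ e∈row₂ | ∈-++⁻ (map proj₁ L) (subst (e ∈_) (map-++ proj₁ L _) e∈bumpers)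
      ... | inj₁ e∈r₂ | inj₁ e∈old = row₂-disjoint-bumpers e∈r₂ e∈old
      ... | inj₁ e∈r₂ | inj₂ (here refl) = x∉u (lookup (subst (r₂ ⊆_) (sym split) (++⁺ʳ sinceLastBump row₂-⊆)) e∈r₂)
      ... | inj₂ (here refl) | inj₂ (here refl) = <-irrefl refl x<z
      ... | inj₂ (here refl) | inj₁ e∈old = <-irrefl refl (<-trans (bumpers<x e∈old) x<z)

      row₁-late′ : ∀ {e} → e ∈ r₁′ → e ∈ afterZ ++ [ x ] ⊎ BelowInversion (u ++ [ x ]) e
      row₁-late′ {e} e∈ with classify e∈
      ... | inj₁ refl = inj₁ (∈-++⁺ʳ afterZ (here refl))
      ... | inj₂ (inj₁ (_ , e<x)) = inj₂ (z , x , zx⊆ , x<z , e<x)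
      ... | inj₂ (inj₂ (e∈r₁ , z<e)) with row₁-late e∈r₁
      ...   | inj₂ below = inj₂ (BelowInversion-++ [ x ] below)
      ...   | inj₁ e∈since with ∈-++⁻ beforeZ (subst (e ∈_) since≡ e∈since)
      ...     | inj₂ (here refl) = ⊥-elim (<-irrefl refl z<e)
      ...     | inj₂ (there e∈after) = inj₁ (∈-++⁺ˡ e∈after)
      ...     | inj₁ e∈before = ⊥-elim (Avoids321⇒¬below-inversion avoids ez⊆u z<e x<z)
        where
        ez⊆u : (e ∷ z ∷ []) ⊆ u
        ez⊆u = subst ((e ∷ z ∷ []) ⊆_) (sym split)
                 (++⁺ˡ upToLastBump (subst ((e ∷ z ∷ []) ⊆_) (sym since≡) (++⁺ (from∈ e∈before) (from∈ (here refl)))))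

data AtMostTwoRows : Tableau → Set where
  no-rows  : AtMostTwoRows []
  one-row  : ∀ r → AtMostTwoRows (r ∷ [])
  two-rows : ∀ r s → AtMostTwoRows (r ∷ s ∷ [])

TableauInvariant : List ℕ → Tableau → List (ℕ × ℕ) → Set
TableauInvariant u T L = AtMostTwoRows T × Invariant u (row1 T) (row2 T) L

row1Bump : Tableau → ℕ → List (ℕ × ℕ)
row1Bump T x with insertRow x (row1 T)
... | _ , nothing = []
... | _ , just z = [ (x , z) ]

bumpsFrom-∷ : ∀ T x xs → bumpsFrom T (x ∷ xs) ≡ row1Bump T x ++ bumpsFrom (insertT x T) xs
bumpsFrom-∷ T x xs with insertRow x (row1 T)
... | _ , nothing = refl
... | _ , just z = refl

TableauInvariant-insertT : ∀ {u T L x} → TableauInvariant u T L →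
                           Unique (u ++ [ x ]) → Avoids321 (u ++ [ x ]) →
                           TableauInvariant (u ++ [ x ]) (insertT x T) (L ++ row1Bump T x)
TableauInvariant-insertT {u} {L = L} {x} (no-rows , I) _ _ =
  one-row [ x ] , subst (Invariant (u ++ [ x ]) [ x ] []) (sym (++-identityʳ L)) (Invariant-append I [])
TableauInvariant-insertT {u} {L = L} {x} (one-row r , I) unique avoids
  with insertRow x r | insertRow-spec x r (Invariant.row₁-increasing I) (x∉row₁ I unique avoids)
... | _ , nothing | appended r<x =
  one-row (r ++ [ x ]) , subst (Invariant (u ++ [ x ]) (r ++ [ x ]) []) (sym (++-identityʳ L)) (Invariant-append I r<x)
... | r′ , just z | bumped x<z z∈r r′↑ classify =
  two-rows r′ [ z ] , Invariant-bump I unique avoids x<z z∈r r′↑ classify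
TableauInvariant-insertT {u} {L = L} {x} (two-rows r s , I) unique avoids
  with insertRow x r | insertRow-spec x r (Invariant.row₁-increasing I) (x∉row₁ I unique avoids)
... | _ , nothing | appended r<x =
  two-rows (r ++ [ x ]) s , subst (Invariant (u ++ [ x ]) (r ++ [ x ]) s) (sym (++-identityʳ L)) (Invariant-append I r<x)
... | r′ , just z | bumped x<z z∈r r′↑ classify
  rewrite insertRow-above-all z s (row₂<bumped I unique avoids x<z z∈r r′↑ classify) =
  two-rows r′ (s ++ [ z ]) , Invariant-bump I unique avoids x<z z∈r r′↑ classify

TableauInvariant-insertAll : ∀ xs {u T L} → TableauInvariant u T L →
                             Unique (u ++ xs) → Avoids321 (u ++ xs) →
                             TableauInvariant (u ++ xs) (insertAll T xs) (L ++ bumpsFrom T xs)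
TableauInvariant-insertAll [] {u} {T} {L} I _ _ =
  subst₂ (λ u′ L′ → TableauInvariant u′ T L′) (sym (++-identityʳ u)) (sym (++-identityʳ L)) I
TableauInvariant-insertAll (x ∷ xs) {u} {T} {L} I unique avoids =
  subst₂ (λ u′ L′ → TableauInvariant u′ (insertAll (insertT x T) xs) L′)
    (++-assoc u [ x ] xs)
    (trans (++-assoc L _ _) (cong (L ++_) (sym (bumpsFrom-∷ T x xs))))
    (TableauInvariant-insertAll xs
      (TableauInvariant-insertT I (Unique-++⁻ˡ (u ++ [ x ]) unique′) (Avoids321-++⁻ˡ xs avoids′))
      unique′ avoids′)
  where
  unique′ : Unique ((u ++ [ x ]) ++ xs)
  unique′ = subst Unique (sym (++-assoc u [ x ] xs)) unique
  avoids′ : Avoids321 ((u ++ [ x ]) ++ xs)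
  avoids′ = subst Avoids321 (sym (++-assoc u [ x ] xs)) avoids

pairs-pointwise : ∀ {A B : Set} (L : List (A × B)) → Pointwise (λ a b → (a , b) ∈ L) (map proj₁ L) (map proj₂ L)
pairs-pointwise [] = []
pairs-pointwise (_ ∷ L) = here refl ∷ Pointwise.map there (pairs-pointwise L)

∈-functional : ∀ {A B : Set} {L : List (A × B)} {a a′ b} → Unique (map proj₂ L) →
               (a , b) ∈ L → (a′ , b) ∈ L → a ≡ a′
∈-functional {L = _ ∷ _} _ (here refl) (here refl) = refl
∈-functional {L = _ ∷ _} (b∉ ∷ _) (here refl) (there ab∈) = ⊥-elim (All.lookup b∉ (∈-map⁺ proj₂ ab∈) refl)
∈-functional {L = _ ∷ _} (b∉ ∷ _) (there ab∈) (here refl) = ⊥-elim (All.lookup b∉ (∈-map⁺ proj₂ ab∈) refl)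
∈-functional {L = _ ∷ _} (_ ∷ U) (there ab∈) (there a′b∈) = ∈-functional U ab∈ a′b∈

Pointwise-∈⇒≡ : ∀ {A B : Set} {L : List (A × B)} {as} → Unique (map proj₂ L) →
                Pointwise (λ a b → (a , b) ∈ L) as (map proj₂ L) → as ≡ map proj₁ L
Pointwise-∈⇒≡ {L = L} unique as∼ =
  Pointwise-≡⇒≡ (Pointwise.transitive (∈-functional unique) as∼ (Pointwise.symmetric id (pairs-pointwise L)))

lemma2p14 : (n : ℕ) (w : List ℕ) → IsPerm n w → FullyCommutative w →
    (row2 (P w) ⊆ w)
    × ((bs : List ℕ) → Pointwise (λ b z → (b , z) ∈ row1Bumps w) bs (row2 (P w)) →
         ((x : ℕ) → x ∈ row2 (P w) → ¬ (x ∈ bs))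
         × Linked _<_ bs
         × (bs ⊆ w))
    × (map proj₂ (row1Bumps w) ≡ row2 (P w))
lemma2p14 n w perm fc = row₂⊆w , bumpers , bumped≡row₂
  where
  open Invariant (proj₂ (TableauInvariant-insertAll w (no-rows , Invariant-[]) (IsPerm⇒Unique n w perm) fc))
  row₂⊆w : row2 (P w) ⊆ w
  row₂⊆w = subst (row2 (P w) ⊆_) (sym split) (++⁺ʳ sinceLastBump row₂-⊆)
  bumpers : (bs : List ℕ) → Pointwise (λ b z → (b , z) ∈ row1Bumps w) bs (row2 (P w)) →
            ((x : ℕ) → x ∈ row2 (P w) → ¬ (x ∈ bs)) × Linked _<_ bs × (bs ⊆ w)
  bumpers≡ : ∀ {bs} → Pointwise (λ b z → (b , z) ∈ row1Bumps w) bs (row2 (P w)) → bs ≡ map proj₁ (row1Bumps w)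
  bumpers≡ {bs} bs∼ = Pointwise-∈⇒≡ (subst Unique (sym bumped≡row₂) (AllPairs.map <⇒≢ row₂-increasing))
                        (subst (Pointwise _ bs) (sym bumped≡row₂) bs∼)
  bumpers bs bs∼ with refl ← bumpers≡ bs∼ =
    (λ _ → row₂-disjoint-bumpers) , AllPairs⇒Linked bumpers-increasing , bumpers-⊆
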